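{- Let $q$ be a power of an odd prime and $k \geq 3$ an integer. For every vertex $v$ of $\Gamma^\square(k,q)$, the subgraph of $\Gamma^\square(k,q)$ induced on the set of neighbours of $v$ is isomorphic to $\Gamma^\square(k-1,q)$.
   Context: For each integer $m\ge 1$: fix a non-square $\xi \in \mathbb{F}_q$ (the same $\xi$ for all $m$) and define $Q_m:\mathbb{F}_q^m \to \mathbb{F}_q$ by $Q_m(x_1,\dots,x_m) = \xi x_1^2 + \sum_{i=2}^m x_i^2$. The points of $\mathrm{PG}(m-1,q)$ are the $1$-dimensional subspaces of $\mathbb{F}_q^m$. Two points $\langle (x_1,\dots,x_m)\rangle$, $\langle (y_1,\dots,y_m)\rangle$ are orthogonal if $\xi x_1y_1 + \sum_{i=2}^m x_iy_i = 0$. The graph $\Gamma^\square(m,q)$ has as vertices the points $x$ of $\mathrm{PG}(m-1,q)$ with $Q_m(x)$ a non-zero square in $\mathbb{F}_q$, two vertices being adjacent iff they are orthogonal. -}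

module Defs where

open import Data.Nat using (ℕ; zero; suc; _^_; _≤_)
open import Data.Nat.Primality using (Prime)
open import Data.Fin using (Fin; zero; suc)
open import Data.Product using (Σ; ∃; _×_; _,_; proj₁)
open import Function using (_∘_)
open import Function.Bundles using (_↔_)
open import Relation.Nullary using (¬_)
open import Relation.Binary.PropositionalEquality using (_≡_; _≢_)
open import Relation.Binary.Definitions using (DecidableEquality)
open import Algebra.Structures using (IsCommutativeRing)

record FiniteField : Set₁ where
  infixl 6 _+_
  infixl 7 _*_
  field
    Carrier     : Set
    _+_ _*_     : Carrier → Carrier → Carrier
    -_          : Carrier → Carrier
    0# 1#       : Carrier
    isCommRing  : IsCommutativeRing _≡_ _+_ _*_ -_ 0# 1#
    0≢1         : 0# ≢ 1#
    inverse     : ∀ x → x ≢ 0# → Σ Carrier λ y → x * y ≡ 1#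
    _≟_         : DecidableEquality Carrier
    order       : ℕ
    enumeration : Carrier ↔ Fin order

-- Simple graphs whose vertex set is given as a type with an equivalence
-- relation (here: nonzero vectors up to scalar multiples = projective points).
record Graph : Set₁ where
  field
    Vertex : Set
    _≈_    : Vertex → Vertex → Set
    Adj    : Vertex → Vertex → Set

Nbhd : (G : Graph) → Graph.Vertex G → Graph
Nbhd G v = record
  { Vertex = Σ (Vertex) (λ w → Adj v w)
  ; _≈_    = λ a b → proj₁ a ≈ proj₁ b
  ; Adj    = λ a b → Adj (proj₁ a) (proj₁ b)
  }
  where open Graph G

record _≅_ (G H : Graph) : Set where
  private
    module G = Graph G
    module H = Graph H
  field
    to       : G.Vertex → H.Vertex
    from     : H.Vertex → G.Vertex
    to-cong  : ∀ {x y} → x G.≈ y → to x H.≈ to y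
    from-cong : ∀ {x y} → x H.≈ y → from x G.≈ from y
    from∘to  : ∀ x → from (to x) G.≈ x
    to∘from  : ∀ y → to (from y) H.≈ y
    adj-to   : ∀ x y → G.Adj x y → H.Adj (to x) (to y)
    adj-from : ∀ x y → H.Adj (to x) (to y) → G.Adj x y

module _ (𝔽 : FiniteField) where
  open FiniteField 𝔽

  IsSquare : Carrier → Set
  IsSquare a = Σ Carrier λ y → y * y ≡ a

  sumF : ∀ {m} → (Fin m → Carrier) → Carrier
  sumF {zero}  f = 0#
  sumF {suc m} f = f zero + sumF (f ∘ suc)

  weight : Carrier → ∀ {m} → Fin m → Carrier
  weight ξ zero    = ξ
  weight ξ (suc i) = 1#

  Bform : Carrier → ∀ m → (Fin m → Carrier) → (Fin m → Carrier) → Carrier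
  Bform ξ m x y = sumF (λ i → weight ξ i * (x i * y i))

  Qform : Carrier → ∀ m → (Fin m → Carrier) → Carrier
  Qform ξ m x = Bform ξ m x x

  -- vertices of Γ^□(m,q): nonzero vectors x with Q_m(x) a nonzero square,
  -- identified up to nonzero scalars (i.e. points of PG(m-1,q)).
  IsVertex : Carrier → ∀ m → (Fin m → Carrier) → Set
  IsVertex ξ m x = (¬ (∀ i → x i ≡ 0#)) × (Qform ξ m x ≢ 0#) × IsSquare (Qform ξ m x)

  Γ□ : Carrier → ℕ → Graph
  Γ□ ξ m = record
    { Vertex = Σ (Fin m → Carrier) (IsVertex ξ m)
    ; _≈_    = λ a b → Σ Carrier λ c → (c ≢ 0#) × (∀ i → proj₁ b i ≡ c * proj₁ a i)
    ; Adj    = λ a b → Bform ξ m (proj₁ a) (proj₁ b) ≡ 0#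
    }

  OddPrimePowerOrder : Set
  OddPrimePowerOrder = ∃ λ p → ∃ λ n → Prime p × (p ≢ 2) × (1 ≤ n) × (order ≡ p ^ n)

module Submission where

-- Let v be a vertex of Γ^□(k,q) with Q(v) = P = s², s ≠ 0, and
-- let w = s·e be s times the first basis vector e of weight 1 (coordinate x₂);
-- then Q(w) = Q(v).  For u = v + t·w with t = ±1 consider the unnormalised
-- reflection  R(x) = Q(u)·x − 2B(x,u)·u.  It is self-adjoint, R∘R = Q(u)², and
-- B(Rx,Ry) = Q(u)²·B(x,y); since Q(v) = Q(w) it sends v to −Q(u)t·w.  In odd
-- characteristic Q(v+w) + Q(v−w) = 4P ≠ 0, so Q(u) ≠ 0 for one choice of t,
-- and then R induces an isomorphism between the neighbourhoods of v and of w.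
-- The neighbours of w are exactly the vertices with vanishing x₂, and deleting
-- that coordinate identifies their induced subgraph with Γ^□(k−1,q).  Odd
-- characteristic follows from ξ being a non-square: in characteristic 2
-- squaring is injective, hence onto, on the finite field.

open import Defs
open import Data.Nat as ℕ using (ℕ; zero; suc; _≤_; _∸_; s≤s)
import Data.Nat.Properties as ℕ
open import Data.Integer as ℤ using (ℤ; -[1+_]; _⊖_; sign; ∣_∣; _◃_)
import Data.Integer.Properties as ℤ
open import Data.Sign as Sign using (Sign)
open import Data.Fin using (Fin; zero; suc; punchOut)
open import Data.Fin.Properties using (any?; punchOut-injective; injective⇒≤) renaming (_≟_ to _≟Fin_)
open import Data.Maybe using (Maybe; just; nothing)
open import Data.Product using (Σ; ∃; _×_; _,_; proj₁; proj₂)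
open import Relation.Nullary using (¬_; yes; no; contradiction)
open import Relation.Binary.Definitions using (Transitive)
open import Relation.Binary.PropositionalEquality
open import Function using (_∘_)
open import Function.Bundles using (Inverse)
open import Algebra.Bundles using (CommutativeRing)
open import Algebra.Structures using (IsCommutativeRing)
open import Algebra.Solver.Ring.AlmostCommutativeRing
  using (fromCommutativeRing; _-Raw-AlmostCommutative⟶_)

-- The ring solver over a finite field, with integer coefficients: the
-- canonical map ℤ → 𝔽 is a ring homomorphism and equality of integers is
-- decidable, so normal forms of polynomial expressions can be compared.
module IntegerCoefficientSolver (𝔽 : FiniteField) where
  open FiniteField 𝔽 using (Carrier; _+_; _*_; -_; 0#; 1#; isCommRing)

  private
    R : CommutativeRing _ _
    R = record { isCommutativeRing = isCommRing }
    open CommutativeRing R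
      using ( semiring; ring; *-commutativeSemigroup; +-assoc; +-comm; +-identityˡ; +-identityʳ
            ; *-identityˡ; *-identityʳ; zeroʳ; -‿inverseʳ)
    open import Algebra.Properties.Ring ring using (-0#≈0#; -‿involutive; -‿+-comm; -‿distribˡ-*; -‿distribʳ-*)
    open import Algebra.Properties.Semiring.Mult semiring using (×-homo-+; ×1-homo-*) renaming (_×_ to _·_)
    open import Algebra.Properties.CommutativeSemigroup *-commutativeSemigroup using (interchange)
    open ≡-Reasoning

    ι : ℕ → Carrier
    ι n = n · 1#

    ⟦_⟧ : ℤ → Carrier
    ⟦ ℤ.+ n ⟧    = ι n
    ⟦ -[1+ n ] ⟧ = - ι (suc n)

    ⊖-homo : ∀ m n → ⟦ m ⊖ n ⟧ ≡ ι m + - ι n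
    ⊖-homo m       zero    = sym (trans (cong (ι m +_) -0#≈0#) (+-identityʳ _))
    ⊖-homo zero    (suc n) = sym (+-identityˡ _)
    ⊖-homo (suc m) (suc n) = begin
      ⟦ suc m ⊖ suc n ⟧                ≡⟨ cong ⟦_⟧ (ℤ.[1+m]⊖[1+n]≡m⊖n m n) ⟩
      ⟦ m ⊖ n ⟧                        ≡⟨ ⊖-homo m n ⟩
      ι m + - ι n                      ≡⟨ cong (_+ - ι n) (sym (+-identityˡ _)) ⟩
      (0# + ι m) + - ι n               ≡⟨ cong (λ z → (z + ι m) + - ι n) (sym (-‿inverseʳ 1#)) ⟩
      ((1# + - 1#) + ι m) + - ι n      ≡⟨ cong (_+ - ι n) (trans (+-assoc _ _ _)
                                            (trans (cong (1# +_) (+-comm _ _)) (sym (+-assoc _ _ _)))) ⟩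
      ((1# + ι m) + - 1#) + - ι n      ≡⟨ +-assoc _ _ _ ⟩
      (1# + ι m) + (- 1# + - ι n)      ≡⟨ cong ((1# + ι m) +_) (-‿+-comm _ _) ⟩
      ι (suc m) + - ι (suc n)          ∎

    +-homo : ∀ i j → ⟦ i ℤ.+ j ⟧ ≡ ⟦ i ⟧ + ⟦ j ⟧
    +-homo (ℤ.+ m)  (ℤ.+ n)  = ×-homo-+ 1# m n
    +-homo (ℤ.+ m)  -[1+ n ] = ⊖-homo m (suc n)
    +-homo -[1+ m ] (ℤ.+ n)  = trans (⊖-homo n (suc m)) (+-comm _ _)
    +-homo -[1+ m ] -[1+ n ] = begin
      - ι (suc (suc (m ℕ.+ n)))   ≡⟨ cong (λ z → - ι (suc z)) (sym (ℕ.+-suc m n)) ⟩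
      - ι (suc m ℕ.+ suc n)       ≡⟨ cong -_ (×-homo-+ 1# (suc m) (suc n)) ⟩
      - (ι (suc m) + ι (suc n))   ≡⟨ sym (-‿+-comm _ _) ⟩
      - ι (suc m) + - ι (suc n)   ∎

    -- Multiplicativity is checked on the sign–magnitude decomposition of ℤ.
    signed : Sign → Carrier
    signed Sign.+ = 1#
    signed Sign.- = - 1#

    ◃-homo : ∀ s n → ⟦ s ◃ n ⟧ ≡ signed s * ι n
    ◃-homo s      zero    = sym (zeroʳ _)
    ◃-homo Sign.+ (suc n) = sym (*-identityˡ _)
    ◃-homo Sign.- (suc n) = trans (cong -_ (sym (*-identityˡ _))) (-‿distribˡ-* 1# _)

    signed-* : ∀ s t → signed (s Sign.* t) ≡ signed s * signed t
    signed-* Sign.+ Sign.+ = sym (*-identityˡ _)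
    signed-* Sign.+ Sign.- = sym (*-identityˡ _)
    signed-* Sign.- Sign.+ = sym (*-identityʳ _)
    signed-* Sign.- Sign.- = begin
      1#             ≡⟨ sym (-‿involutive 1#) ⟩
      - - 1#         ≡⟨ cong -_ (sym (*-identityʳ (- 1#))) ⟩
      - (- 1# * 1#)  ≡⟨ -‿distribʳ-* _ _ ⟩
      - 1# * - 1#    ∎

    sign-abs : ∀ i → ⟦ i ⟧ ≡ signed (sign i) * ι ∣ i ∣
    sign-abs i = trans (cong ⟦_⟧ (sym (ℤ.◃-inverse i))) (◃-homo (sign i) ∣ i ∣)

    *-homo : ∀ i j → ⟦ i ℤ.* j ⟧ ≡ ⟦ i ⟧ * ⟦ j ⟧
    *-homo i j = begin
      ⟦ (sign i Sign.* sign j) ◃ (∣ i ∣ ℕ.* ∣ j ∣) ⟧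
        ≡⟨ ◃-homo (sign i Sign.* sign j) (∣ i ∣ ℕ.* ∣ j ∣) ⟩
      signed (sign i Sign.* sign j) * ι (∣ i ∣ ℕ.* ∣ j ∣)
        ≡⟨ cong₂ _*_ (signed-* (sign i) (sign j)) (×1-homo-* ∣ i ∣ ∣ j ∣) ⟩
      (signed (sign i) * signed (sign j)) * (ι ∣ i ∣ * ι ∣ j ∣)
        ≡⟨ interchange _ _ _ _ ⟩
      (signed (sign i) * ι ∣ i ∣) * (signed (sign j) * ι ∣ j ∣)
        ≡⟨ sym (cong₂ _*_ (sign-abs i) (sign-abs j)) ⟩
      ⟦ i ⟧ * ⟦ j ⟧ ∎

    neg-homo : ∀ i → ⟦ ℤ.- i ⟧ ≡ - ⟦ i ⟧
    neg-homo (ℤ.+ zero)  = sym -0#≈0#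
    neg-homo (ℤ.+ suc n) = refl
    neg-homo -[1+ n ]    = sym (-‿involutive _)

    homomorphism : ℤ.+-*-rawRing -Raw-AlmostCommutative⟶ fromCommutativeRing R
    homomorphism = record
      { ⟦_⟧ = ⟦_⟧ ; +-homo = +-homo ; *-homo = *-homo ; -‿homo = neg-homo
      ; 0-homo = refl ; 1-homo = +-identityʳ 1# }

    ⟦⟧-weaklyDec : ∀ i j → Maybe (⟦ i ⟧ ≡ ⟦ j ⟧)
    ⟦⟧-weaklyDec i j with i ℤ.≟ j
    ... | yes i≡j = just (cong ⟦_⟧ i≡j)
    ... | no _    = nothing

  open import Algebra.Solver.Ring ℤ.+-*-rawRing (fromCommutativeRing R) homomorphism ⟦⟧-weaklyDec public

-- An injective self-map of a finite set is onto: a missed value would let us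
-- inject Fin (suc n) into Fin n.
Fin-injective⇒surjective : ∀ n (f : Fin n → Fin n) → (∀ {a b} → f a ≡ f b → a ≡ b) →
                           ∀ j → ∃ λ i → f i ≡ j
Fin-injective⇒surjective zero    f inj ()
Fin-injective⇒surjective (suc n) f inj j with any? (λ i → f i ≟Fin j)
... | yes hit = hit
... | no miss = contradiction (injective⇒≤ {f = avoid-j} avoid-j-injective) ℕ.1+n≰n
  where
  j≢f : ∀ i → j ≢ f i
  j≢f i e = miss (i , sym e)
  avoid-j : Fin (suc n) → Fin n
  avoid-j i = punchOut (j≢f i)
  avoid-j-injective : ∀ {a b} → avoid-j a ≡ avoid-j b → a ≡ b
  avoid-j-injective e = inj (punchOut-injective (j≢f _) (j≢f _) e)

≅-trans : ∀ {G H K : Graph} → Transitive (Graph._≈_ G) → Transitive (Graph._≈_ K) →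
          G ≅ H → H ≅ K → G ≅ K
≅-trans G-trans K-trans i j = record
  { to        = J.to ∘ I.to
  ; from      = I.from ∘ J.from
  ; to-cong   = J.to-cong ∘ I.to-cong
  ; from-cong = I.from-cong ∘ J.from-cong
  ; from∘to   = λ x → G-trans (I.from-cong (J.from∘to (I.to x))) (I.from∘to x)
  ; to∘from   = λ y → K-trans (J.to-cong (I.to∘from (J.from y))) (J.to∘from y)
  ; adj-to    = λ x y → J.adj-to (I.to x) (I.to y) ∘ I.adj-to x y
  ; adj-from  = λ x y → I.adj-from x y ∘ J.adj-from (I.to x) (I.to y)
  }
  where
  module I = _≅_ i
  module J = _≅_ j

module FieldLemmas (𝔽 : FiniteField) where
  open FiniteField 𝔽
  open IsCommutativeRing isCommRing
    using (*-comm; *-assoc; zeroˡ; zeroʳ; *-identityˡ; +-identityˡ; distribˡ; distribʳ)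
    public
  open IntegerCoefficientSolver 𝔽 using (solve; _:+_; _:*_; :-_; _:=_; con) public
  open ≡-Reasoning

  unit-nonzero : ∀ {a b} → a * b ≡ 1# → b ≢ 0#
  unit-nonzero {a} {b} ab≡1 b≡0 = 0≢1 (begin
    0#      ≡⟨ sym (zeroʳ a) ⟩
    a * 0#  ≡⟨ cong (a *_) (sym b≡0) ⟩
    a * b   ≡⟨ ab≡1 ⟩
    1#      ∎)

  divide : ∀ {c} → c ≢ 0# → Σ Carrier λ d → (d ≢ 0#) × (∀ x → x ≡ d * (c * x))
  divide {c} c≢0 with inverse c c≢0
  ... | c⁻¹ , cc⁻¹≡1 = c⁻¹ , unit-nonzero cc⁻¹≡1 , λ x → begin
    x               ≡⟨ sym (*-identityˡ x) ⟩
    1# * x          ≡⟨ cong (_* x) (sym cc⁻¹≡1) ⟩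
    (c * c⁻¹) * x   ≡⟨ solve 3 (λ c d x → (c :* d) :* x := d :* (c :* x)) refl c c⁻¹ x ⟩
    c⁻¹ * (c * x)   ∎

  cancel-nonzero : ∀ {a b} → a ≢ 0# → a * b ≡ 0# → b ≡ 0#
  cancel-nonzero {a} {b} a≢0 ab≡0 with d , _ , b≡dab ← divide a≢0 = begin
    b              ≡⟨ b≡dab b ⟩
    d * (a * b)    ≡⟨ cong (d *_) ab≡0 ⟩
    d * 0#         ≡⟨ zeroʳ d ⟩
    0#             ∎

  *-nonzero : ∀ {a b} → a ≢ 0# → b ≢ 0# → a * b ≢ 0#
  *-nonzero a≢0 b≢0 ab≡0 = b≢0 (cancel-nonzero a≢0 ab≡0)

  -‿nonzero : ∀ {a} → a ≢ 0# → - a ≢ 0#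
  -‿nonzero {a} a≢0 -a≡0 = a≢0 (begin
    a        ≡⟨ solve 1 (λ a → a := :- (:- a)) refl a ⟩
    - (- a)  ≡⟨ cong -_ -a≡0 ⟩
    - 0#     ≡⟨ solve 0 (:- con (ℤ.+ 0) := con (ℤ.+ 0)) refl ⟩
    0#       ∎)

  square≡0 : ∀ {a} → a * a ≡ 0# → a ≡ 0#
  square≡0 {a} aa≡0 with a ≟ 0#
  ... | yes a≡0 = a≡0
  ... | no  a≢0 = cancel-nonzero a≢0 aa≡0

  -- An injective self-map of 𝔽 is onto (transport along 𝔽 ↔ Fin q).
  injective⇒surjective : (f : Carrier → Carrier) → (∀ {a b} → f a ≡ f b → a ≡ b) →
                         ∀ y → ∃ λ x → f x ≡ y
  injective⇒surjective f inj y = from i , (begin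
      f (from i)              ≡⟨ sym (strictlyInverseʳ _) ⟩
      from (to (f (from i)))  ≡⟨ cong from (proj₂ preimage) ⟩
      from (to y)             ≡⟨ strictlyInverseʳ y ⟩
      y                       ∎)
    where
    open Inverse enumeration using (to; from; strictlyInverseˡ; strictlyInverseʳ)
    onFin-injective : ∀ {i j} → to (f (from i)) ≡ to (f (from j)) → i ≡ j
    onFin-injective {i} {j} e = begin
      i            ≡⟨ sym (strictlyInverseˡ i) ⟩
      to (from i)  ≡⟨ cong to (inj (trans (sym (strictlyInverseʳ _)) (trans (cong from e) (strictlyInverseʳ _)))) ⟩
      to (from j)  ≡⟨ strictlyInverseˡ j ⟩
      j            ∎
    preimage : ∃ λ i → to (f (from i)) ≡ to y
    preimage = Fin-injective⇒surjective order (to ∘ f ∘ from) onFin-injective (to y)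
    i : Fin order
    i = proj₁ preimage

  two : Carrier
  two = 1# + 1#

  double : ∀ a → a + a ≡ two * a
  double a = sym (trans (distribʳ a 1# 1#) (cong₂ _+_ (*-identityˡ a) (*-identityˡ a)))

  -- In characteristic 2 squaring is injective, hence onto: every element of
  -- 𝔽 is a square.
  char2⇒square : two ≡ 0# → ∀ a → IsSquare 𝔽 a
  char2⇒square two≡0 = injective⇒surjective (λ x → x * x) square-injective
    where
    double≡0 : ∀ a → a + a ≡ 0#
    double≡0 a = trans (double a) (trans (cong (_* a) two≡0) (zeroˡ a))
    square-injective : ∀ {x y} → x * x ≡ y * y → x ≡ y
    square-injective {x} {y} xx≡yy = begin
      x                        ≡⟨ solve 2 (λ x y → x := (x :+ y) :+ y :+ :- (y :+ y)) refl x y ⟩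
      (x + y) + y + - (y + y)  ≡⟨ cong₂ (λ a b → a + y + - b) sum≡0 (double≡0 y) ⟩
      0# + y + - 0#            ≡⟨ solve 1 (λ y → con (ℤ.+ 0) :+ y :+ :- con (ℤ.+ 0) := y) refl y ⟩
      y                        ∎
      where
      sum≡0 : x + y ≡ 0#
      sum≡0 = square≡0 (begin
        (x + y) * (x + y)
          ≡⟨ solve 2 (λ x y → (x :+ y) :* (x :+ y) := x :* x :+ y :* y :+ (x :* y :+ x :* y)) refl x y ⟩
        x * x + y * y + (x * y + x * y)  ≡⟨ cong₂ (λ a b → a + y * y + b) xx≡yy (double≡0 (x * y)) ⟩
        y * y + y * y + 0#               ≡⟨ cong (_+ 0#) (double≡0 (y * y)) ⟩
        0# + 0#                          ≡⟨ +-identityˡ 0# ⟩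
        0#                               ∎)

module Forms (𝔽 : FiniteField) (ξ : FiniteField.Carrier 𝔽) where
  open FiniteField 𝔽
  open FieldLemmas 𝔽
  open ≡-Reasoning

  Coords : ℕ → Set
  Coords m = Fin m → Carrier

  Vertex : ℕ → Set
  Vertex m = Graph.Vertex (Γ□ 𝔽 ξ m)

  Σᶠ : ∀ {m} → Coords m → Carrier
  Σᶠ = sumF 𝔽

  B : ∀ {m} → Coords m → Coords m → Carrier
  B {m} = Bform 𝔽 ξ m

  wt : ∀ {m} → Fin m → Carrier
  wt = weight 𝔽 ξ

  sum-cong : ∀ {m} {f g : Coords m} → (∀ i → f i ≡ g i) → Σᶠ f ≡ Σᶠ g
  sum-cong {zero}  f≗g = refl
  sum-cong {suc m} f≗g = cong₂ _+_ (f≗g zero) (sum-cong (f≗g ∘ suc))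

  sum-+ : ∀ {m} (f g : Coords m) → Σᶠ (λ i → f i + g i) ≡ Σᶠ f + Σᶠ g
  sum-+ {zero}  f g = sym (+-identityˡ 0#)
  sum-+ {suc m} f g = begin
    (f zero + g zero) + Σᶠ (λ i → f (suc i) + g (suc i))
      ≡⟨ cong (f zero + g zero +_) (sum-+ (f ∘ suc) (g ∘ suc)) ⟩
    (f zero + g zero) + (Σᶠ (f ∘ suc) + Σᶠ (g ∘ suc))
      ≡⟨ solve 4 (λ a b c d → (a :+ b) :+ (c :+ d) := (a :+ c) :+ (b :+ d)) refl
           (f zero) (g zero) (Σᶠ (f ∘ suc)) (Σᶠ (g ∘ suc)) ⟩
    (f zero + Σᶠ (f ∘ suc)) + (g zero + Σᶠ (g ∘ suc)) ∎

  sum-* : ∀ {m} c (f : Coords m) → Σᶠ (λ i → c * f i) ≡ c * Σᶠ f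
  sum-* {zero}  c f = sym (zeroʳ c)
  sum-* {suc m} c f = trans (cong (c * f zero +_) (sum-* c (f ∘ suc))) (sym (distribˡ c _ _))

  sum-zero : ∀ {m} (f : Coords m) → (∀ i → f i ≡ 0#) → Σᶠ f ≡ 0#
  sum-zero {zero}  f f≗0 = refl
  sum-zero {suc m} f f≗0 = trans (cong₂ _+_ (f≗0 zero) (sum-zero (f ∘ suc) (f≗0 ∘ suc))) (+-identityˡ 0#)

  B-sym : ∀ {m} (x y : Coords m) → B x y ≡ B y x
  B-sym x y = sum-cong (λ i → cong (wt i *_) (*-comm (x i) (y i)))

  B-congˡ : ∀ {m} {x x' : Coords m} z → (∀ i → x i ≡ x' i) → B x z ≡ B x' z
  B-congˡ z x≗x' = sum-cong (λ i → cong (λ a → wt i * (a * z i)) (x≗x' i))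

  B-congʳ : ∀ {m} x {z z' : Coords m} → (∀ i → z i ≡ z' i) → B x z ≡ B x z'
  B-congʳ x z≗z' = trans (B-sym x _) (trans (B-congˡ x z≗z') (B-sym _ x))

  B-linearˡ : ∀ {m} a (x : Coords m) b y z →
              B (λ i → a * x i + b * y i) z ≡ a * B x z + b * B y z
  B-linearˡ {m} a x b y z = begin
    Σᶠ (λ i → wt {m} i * ((a * x i + b * y i) * z i))  ≡⟨ sum-cong termwise ⟩
    Σᶠ (λ i → a * xz i + b * yz i)                     ≡⟨ sum-+ (λ i → a * xz i) (λ i → b * yz i) ⟩
    Σᶠ (λ i → a * xz i) + Σᶠ (λ i → b * yz i)          ≡⟨ cong₂ _+_ (sum-* a xz) (sum-* b yz) ⟩
    a * B x z + b * B y z                              ∎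
    where
    xz yz : Fin m → Carrier
    xz i = wt i * (x i * z i)
    yz i = wt i * (y i * z i)
    termwise : ∀ i → wt i * ((a * x i + b * y i) * z i) ≡ a * xz i + b * yz i
    termwise i = solve 6
      (λ w a x b y z → w :* ((a :* x :+ b :* y) :* z) := a :* (w :* (x :* z)) :+ b :* (w :* (y :* z)))
      refl (wt i) a (x i) b (y i) (z i)

  B-scaleˡ : ∀ {m} c (x z : Coords m) → B (λ i → c * x i) z ≡ c * B x z
  B-scaleˡ {m} c x z = trans (sum-cong termwise) (sum-* c (λ i → wt {m} i * (x i * z i)))
    where
    termwise : ∀ i → wt i * ((c * x i) * z i) ≡ c * (wt i * (x i * z i))
    termwise i = solve 4 (λ w c x z → w :* ((c :* x) :* z) := c :* (w :* (x :* z))) refl (wt i) c (x i) (z i)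

  B-scaleʳ : ∀ {m} c (x z : Coords m) → B x (λ i → c * z i) ≡ c * B x z
  B-scaleʳ c x z = trans (B-sym x _) (trans (B-scaleˡ c z x) (cong (c *_) (B-sym z x)))

  B-addˡ : ∀ {m} (x : Coords m) t y z → B (λ i → x i + t * y i) z ≡ B x z + t * B y z
  B-addˡ x t y z = begin
    B (λ i → x i + t * y i) z          ≡⟨ B-congˡ z (λ i → cong (_+ t * y i) (sym (*-identityˡ (x i)))) ⟩
    B (λ i → 1# * x i + t * y i) z     ≡⟨ B-linearˡ 1# x t y z ⟩
    1# * B x z + t * B y z             ≡⟨ cong (_+ t * B y z) (*-identityˡ _) ⟩
    B x z + t * B y z                  ∎

  Q-expand : ∀ {m} (x : Coords m) t y →
             B (λ i → x i + t * y i) (λ i → x i + t * y i) ≡ B x x + (t + t) * B x y + (t * t) * B y y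
  Q-expand x t y = begin
    B u u                                    ≡⟨ B-addˡ x t y u ⟩
    B x u + t * B y u                        ≡⟨ cong₂ (λ a b → a + t * b) (B-sym x u) (B-sym y u) ⟩
    B u x + t * B u y                        ≡⟨ cong₂ (λ a b → a + t * b) (B-addˡ x t y x) (B-addˡ x t y y) ⟩
    (B x x + t * B y x) + t * (B x y + t * B y y)
                                             ≡⟨ cong (λ a → (B x x + t * a) + t * (B x y + t * B y y)) (B-sym y x) ⟩
    (B x x + t * B x y) + t * (B x y + t * B y y)
      ≡⟨ solve 4 (λ q t b r → (q :+ t :* b) :+ t :* (b :+ t :* r) := q :+ (t :+ t) :* b :+ (t :* t) :* r)
           refl (B x x) t (B x y) (B y y) ⟩
    B x x + (t + t) * B x y + (t * t) * B y y ∎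
    where
    u = λ i → x i + t * y i

  Q-zero : ∀ {m} (z : Coords m) → (∀ i → z i ≡ 0#) → B z z ≡ 0#
  Q-zero z z≗0 = sum-zero _ (λ i → begin
    wt i * (z i * z i)  ≡⟨ cong (λ a → wt i * (a * a)) (z≗0 i) ⟩
    wt i * (0# * 0#)    ≡⟨ cong (wt i *_) (zeroʳ 0#) ⟩
    wt i * 0#           ≡⟨ zeroʳ _ ⟩
    0#                  ∎)

  vertex-rescaled : ∀ {m m'} (z : Coords m) (x : Coords m') c → c ≢ 0# →
                    B z z ≡ (c * c) * B x x → IsVertex 𝔽 ξ m' x → IsVertex 𝔽 ξ m z
  vertex-rescaled z x c c≢0 Qz≡ (_ , Qx≢0 , r , rr≡Qx) =
    (λ z≗0 → Qz≢0 (Q-zero z z≗0)) ,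
    Qz≢0 ,
    (c * r , (begin
      (c * r) * (c * r)  ≡⟨ solve 2 (λ c r → (c :* r) :* (c :* r) := (c :* c) :* (r :* r)) refl c r ⟩
      (c * c) * (r * r)  ≡⟨ cong ((c * c) *_) rr≡Qx ⟩
      (c * c) * B x x    ≡⟨ sym Qz≡ ⟩
      B z z              ∎))
    where
    Qz≢0 : B z z ≢ 0#
    Qz≢0 Qz≡0 = *-nonzero (*-nonzero c≢0 c≢0) Qx≢0 (trans (sym Qz≡) Qz≡0)

  vertex-sameQ : ∀ {m m'} (z : Coords m) (x : Coords m') →
                 B z z ≡ B x x → IsVertex 𝔽 ξ m' x → IsVertex 𝔽 ξ m z
  vertex-sameQ z x Qz≡Qx = vertex-rescaled z x 1# (λ 1≡0 → 0≢1 (sym 1≡0))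
    (trans Qz≡Qx (sym (trans (cong (_* B x x) (*-identityˡ 1#)) (*-identityˡ _))))

  Proportional : ∀ {m} → Coords m → Coords m → Set
  Proportional x y = Σ Carrier λ c → (c ≢ 0#) × (∀ i → y i ≡ c * x i)

  ≗⇒proportional : ∀ {m} {x y : Coords m} → (∀ i → x i ≡ y i) → Proportional x y
  ≗⇒proportional {x = x} x≗y =
    1# , (λ 1≡0 → 0≢1 (sym 1≡0)) , λ i → trans (sym (x≗y i)) (sym (*-identityˡ (x i)))

  proportional-sym : ∀ {m} {x y : Coords m} → Proportional x y → Proportional y x
  proportional-sym {x = x} (c , c≢0 , y≗cx) with divide c≢0
  ... | d , d≢0 , x≡dcx = d , d≢0 , λ i → trans (x≡dcx (x i)) (cong (d *_) (sym (y≗cx i)))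

  proportional-trans : ∀ {m} {x y z : Coords m} → Proportional x y → Proportional y z → Proportional x z
  proportional-trans {x = x} (c , c≢0 , y≗cx) (d , d≢0 , z≗dy) =
    d * c , *-nonzero d≢0 c≢0 , λ i → trans (z≗dy i) (trans (cong (d *_) (y≗cx i)) (sym (*-assoc d c (x i))))

  Γ□-≈-trans : ∀ m → Transitive (Graph._≈_ (Γ□ 𝔽 ξ m))
  Γ□-≈-trans m = proportional-trans

  Nbhd-≈-trans : ∀ m (v : Vertex m) → Transitive (Graph._≈_ (Nbhd (Γ□ 𝔽 ξ m) v))
  Nbhd-≈-trans m v = proportional-trans

  module Reflection {m} (u : Coords m) where
    α : Carrier
    α = B u u

    R : Coords m → Coords m
    R x i = α * x i + (- (B x u + B x u)) * u i

    B-R : ∀ x z → B (R x) z ≡ α * B x z + (- (B x u + B x u)) * B u z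
    B-R x z = B-linearˡ α x (- (B x u + B x u)) u z

    R-selfAdjoint : ∀ x y → B (R x) y ≡ B x (R y)
    R-selfAdjoint x y = begin
      B (R x) y
        ≡⟨ B-R x y ⟩
      α * B x y + (- (B x u + B x u)) * B u y
        ≡⟨ cong₂ (λ a b → α * a + (- (B x u + B x u)) * b) (B-sym x y) (B-sym u y) ⟩
      α * B y x + (- (B x u + B x u)) * B y u
        ≡⟨ solve 4 (λ a b p q → a :* b :+ (:- (p :+ p)) :* q := a :* b :+ (:- (q :+ q)) :* p)
             refl α (B y x) (B x u) (B y u) ⟩
      α * B y x + (- (B y u + B y u)) * B x u
        ≡⟨ cong (λ b → α * B y x + (- (B y u + B y u)) * b) (B-sym x u) ⟩
      α * B y x + (- (B y u + B y u)) * B u x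
        ≡⟨ sym (B-R y x) ⟩
      B (R y) x
        ≡⟨ B-sym (R y) x ⟩
      B x (R y) ∎

    B-R-u : ∀ x → B (R x) u ≡ - (α * B x u)
    B-R-u x = trans (B-R x u)
      (solve 2 (λ a b → a :* b :+ (:- (b :+ b)) :* a := :- (a :* b)) refl α (B x u))

    R-involutive : ∀ x i → R (R x) i ≡ (α * α) * x i
    R-involutive x i = begin
      α * R x i + (- (B (R x) u + B (R x) u)) * u i
        ≡⟨ cong (λ p → α * R x i + (- (p + p)) * u i) (B-R-u x) ⟩
      α * (α * x i + (- (b + b)) * u i) + (- (- (α * b) + - (α * b))) * u i
        ≡⟨ solve 4 (λ a b xi ui →
             a :* (a :* xi :+ (:- (b :+ b)) :* ui) :+ (:- (:- (a :* b) :+ :- (a :* b))) :* ui := (a :* a) :* xi)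
             refl α b (x i) (u i) ⟩
      (α * α) * x i ∎
      where
      b = B x u

    R-similitude : ∀ x y → B (R x) (R y) ≡ (α * α) * B x y
    R-similitude x y = begin
      B (R x) (R y)                ≡⟨ R-selfAdjoint x (R y) ⟩
      B x (R (R y))                ≡⟨ B-congʳ x (R-involutive y) ⟩
      B x (λ i → (α * α) * y i)    ≡⟨ B-scaleʳ (α * α) x y ⟩
      (α * α) * B x y              ∎

    R-scale : ∀ {x y} c → (∀ i → y i ≡ c * x i) → ∀ i → R y i ≡ c * R x i
    R-scale {x} {y} c y≗cx i = begin
      α * y i + (- (B y u + B y u)) * u i
        ≡⟨ cong₂ (λ p q → α * p + (- (q + q)) * u i) (y≗cx i) (trans (B-congˡ u y≗cx) (B-scaleˡ c x u)) ⟩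
      α * (c * x i) + (- (c * B x u + c * B x u)) * u i
        ≡⟨ solve 5 (λ a c xi b ui → a :* (c :* xi) :+ (:- (c :* b :+ c :* b)) :* ui
              := c :* (a :* xi :+ (:- (b :+ b)) :* ui)) refl α c (x i) (B x u) (u i) ⟩
      c * R x i ∎

    R-proportional : ∀ {x y} → Proportional x y → Proportional (R x) (R y)
    R-proportional (c , c≢0 , y≗cx) = c , c≢0 , R-scale c y≗cx

    module _ (α≢0 : α ≢ 0#) where
      α²≢0 : α * α ≢ 0#
      α²≢0 = *-nonzero α≢0 α≢0

      R-vertex : ∀ {x} → IsVertex 𝔽 ξ m x → IsVertex 𝔽 ξ m (R x)
      R-vertex {x} = vertex-rescaled (R x) x α α≢0 (R-similitude x x)

      R-back : ∀ x → Proportional (R (R x)) x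
      R-back x = proportional-sym (α * α , α²≢0 , R-involutive x)

      reflect-Nbhd≅ : (x y : Vertex m) → ∀ μ → μ ≢ 0# → (∀ i → R (proj₁ x) i ≡ μ * proj₁ y i) →
                      Nbhd (Γ□ 𝔽 ξ m) x ≅ Nbhd (Γ□ 𝔽 ξ m) y
      reflect-Nbhd≅ (x , _) (y , _) μ μ≢0 Rx≗μy = record
        { to        = λ { ((z , z-vertex) , x⊥z) → (R z , R-vertex z-vertex) , y⊥Rz z x⊥z }
        ; from      = λ { ((z , z-vertex) , y⊥z) → (R z , R-vertex z-vertex) , x⊥Rz z y⊥z }
        ; to-cong   = R-proportional
        ; from-cong = R-proportional
        ; from∘to   = λ z → R-back (proj₁ (proj₁ z))
        ; to∘from   = λ z → R-back (proj₁ (proj₁ z))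
        ; adj-to    = λ z z' z⊥z' → trans (R-similitude _ _) (trans (cong ((α * α) *_) z⊥z') (zeroʳ _))
        ; adj-from  = λ z z' Rz⊥Rz' → cancel-nonzero α²≢0 (trans (sym (R-similitude _ _)) Rz⊥Rz')
        }
        where
        y⊥Rz : ∀ z → B x z ≡ 0# → B y (R z) ≡ 0#
        y⊥Rz z x⊥z = cancel-nonzero μ≢0 (begin
          μ * B y (R z)              ≡⟨ sym (B-scaleˡ μ y (R z)) ⟩
          B (λ i → μ * y i) (R z)    ≡⟨ sym (B-congˡ (R z) Rx≗μy) ⟩
          B (R x) (R z)              ≡⟨ R-similitude x z ⟩
          (α * α) * B x z            ≡⟨ cong ((α * α) *_) x⊥z ⟩
          (α * α) * 0#               ≡⟨ zeroʳ _ ⟩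
          0#                         ∎)
        x⊥Rz : ∀ z → B y z ≡ 0# → B x (R z) ≡ 0#
        x⊥Rz z y⊥z = begin
          B x (R z)                  ≡⟨ sym (R-selfAdjoint x z) ⟩
          B (R x) z                  ≡⟨ B-congˡ z Rx≗μy ⟩
          B (λ i → μ * y i) z        ≡⟨ B-scaleˡ μ y z ⟩
          μ * B y z                  ≡⟨ cong (μ *_) y⊥z ⟩
          μ * 0#                     ≡⟨ zeroʳ μ ⟩
          0#                         ∎

  -- The coordinate x₂ (index 1, weight 1) of 𝔽^(m+2), and the neighbourhood
  -- of the vertex spanned by a multiple of the corresponding basis vector.
  module Axis (m : ℕ) where
    axis : Carrier → Coords (suc (suc m))
    axis a zero          = 0#
    axis a (suc zero)    = a
    axis a (suc (suc i)) = 0#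

    B-axis : ∀ a z → B (axis a) z ≡ a * z (suc zero)
    B-axis a z = begin
      ξ * (0# * z zero) + (1# * (a * z (suc zero)) + Σᶠ (λ i → 1# * (0# * z (suc (suc i)))))
        ≡⟨ cong₂ (λ p q → ξ * p + (1# * (a * z (suc zero)) + q)) (zeroˡ _)
             (sum-zero (λ i → 1# * (0# * z (suc (suc i)))) (λ i → trans (cong (1# *_) (zeroˡ _)) (zeroʳ 1#))) ⟩
      ξ * 0# + (1# * (a * z (suc zero)) + 0#)
        ≡⟨ solve 3 (λ ξ o p → ξ :* con (ℤ.+ 0) :+ (o :* p :+ con (ℤ.+ 0)) := o :* p)
             refl ξ 1# (a * z (suc zero)) ⟩
      1# * (a * z (suc zero))
        ≡⟨ *-identityˡ _ ⟩
      a * z (suc zero) ∎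

    axis-vertex : ∀ {a} → a ≢ 0# → IsVertex 𝔽 ξ (suc (suc m)) (axis a)
    axis-vertex {a} a≢0 =
      (λ axis≗0 → a≢0 (axis≗0 (suc zero))) ,
      (λ Q≡0 → *-nonzero a≢0 a≢0 (trans (sym (B-axis a (axis a))) Q≡0)) ,
      (a , sym (B-axis a (axis a)))

    delete : Coords (suc (suc m)) → Coords (suc m)
    delete z zero    = z zero
    delete z (suc i) = z (suc (suc i))

    insert0 : Coords (suc m) → Coords (suc (suc m))
    insert0 y zero          = y zero
    insert0 y (suc zero)    = 0#
    insert0 y (suc (suc i)) = y (suc i)

    B-delete : ∀ z z' → z (suc zero) ≡ 0# → B z z' ≡ B (delete z) (delete z')
    B-delete z z' z₂≡0 = cong (ξ * (z zero * z' zero) +_) (begin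
      1# * (z (suc zero) * z' (suc zero)) + rest  ≡⟨ cong (λ a → 1# * (a * z' (suc zero)) + rest) z₂≡0 ⟩
      1# * (0# * z' (suc zero)) + rest            ≡⟨ cong (λ a → 1# * a + rest) (zeroˡ _) ⟩
      1# * 0# + rest                              ≡⟨ cong (_+ rest) (zeroʳ 1#) ⟩
      0# + rest                                   ≡⟨ +-identityˡ rest ⟩
      rest                                        ∎)
      where
      rest = Σᶠ (λ i → 1# * (z (suc (suc i)) * z' (suc (suc i))))

    B-insert0 : ∀ y y' → B (insert0 y) (insert0 y') ≡ B y y'
    B-insert0 y y' = cong (ξ * (y zero * y' zero) +_) (begin
      1# * (0# * 0#) + rest  ≡⟨ cong (λ a → 1# * a + rest) (zeroˡ 0#) ⟩
      1# * 0# + rest         ≡⟨ cong (_+ rest) (zeroʳ 1#) ⟩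
      0# + rest              ≡⟨ +-identityˡ rest ⟩
      rest                   ∎)
      where
      rest = Σᶠ (λ i → 1# * (y (suc i) * y' (suc i)))

    insert0-delete : ∀ z → z (suc zero) ≡ 0# → ∀ i → insert0 (delete z) i ≡ z i
    insert0-delete z z₂≡0 zero          = refl
    insert0-delete z z₂≡0 (suc zero)    = sym z₂≡0
    insert0-delete z z₂≡0 (suc (suc i)) = refl

    delete-insert0 : ∀ y i → delete (insert0 y) i ≡ y i
    delete-insert0 y zero    = refl
    delete-insert0 y (suc i) = refl

    axis-Nbhd≅ : ∀ {a} (a≢0 : a ≢ 0#) →
                 Nbhd (Γ□ 𝔽 ξ (suc (suc m))) (axis a , axis-vertex a≢0) ≅ Γ□ 𝔽 ξ (suc m)
    axis-Nbhd≅ {a} a≢0 = record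
      { to        = λ { ((z , z-vertex) , e⊥z) →
                        delete z , vertex-sameQ (delete z) z (sym (B-delete z z (x₂≡0 z e⊥z))) z-vertex }
      ; from      = λ { (y , y-vertex) →
                        (insert0 y , vertex-sameQ (insert0 y) y (B-insert0 y y) y-vertex) ,
                        trans (B-axis a (insert0 y)) (zeroʳ a) }
      ; to-cong   = λ { (c , c≢0 , z'≗cz) → c , c≢0 , λ { zero → z'≗cz zero ; (suc i) → z'≗cz (suc (suc i)) } }
      ; from-cong = λ { (c , c≢0 , y'≗cy) → c , c≢0 ,
                        λ { zero → y'≗cy zero ; (suc zero) → sym (zeroʳ c) ; (suc (suc i)) → y'≗cy (suc i) } }
      ; from∘to   = λ { ((z , _) , e⊥z) → ≗⇒proportional (insert0-delete z (x₂≡0 z e⊥z)) }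
      ; to∘from   = λ { (y , _) → ≗⇒proportional (delete-insert0 y) }
      ; adj-to    = λ { ((z , _) , e⊥z) ((z' , _) , _) z⊥z' → trans (sym (B-delete z z' (x₂≡0 z e⊥z))) z⊥z' }
      ; adj-from  = λ { ((z , _) , e⊥z) ((z' , _) , _) z⊥z' → trans (B-delete z z' (x₂≡0 z e⊥z)) z⊥z' }
      }
      where
      x₂≡0 : ∀ z → B (axis a) z ≡ 0# → z (suc zero) ≡ 0#
      x₂≡0 z e⊥z = cancel-nonzero a≢0 (trans (sym (B-axis a z)) e⊥z)

module Neighbourhood (𝔽 : FiniteField) (ξ : FiniteField.Carrier 𝔽) (ξ-nonsquare : ¬ IsSquare 𝔽 ξ)
                     (m : ℕ) (v : Graph.Vertex (Γ□ 𝔽 ξ (suc (suc m)))) where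
  open FiniteField 𝔽
  open FieldLemmas 𝔽
  open Forms 𝔽 ξ
  open Axis m
  open ≡-Reasoning

  x : Coords (suc (suc m))
  x = proj₁ v

  P : Carrier
  P = B x x

  P≢0 : P ≢ 0#
  P≢0 = proj₁ (proj₂ (proj₂ v))

  s : Carrier
  s = proj₁ (proj₂ (proj₂ (proj₂ v)))

  ss≡P : s * s ≡ P
  ss≡P = proj₂ (proj₂ (proj₂ (proj₂ v)))

  s≢0 : s ≢ 0#
  s≢0 s≡0 = P≢0 (trans (sym ss≡P) (trans (cong (λ a → a * a) s≡0) (zeroˡ 0#)))

  w : Coords (suc (suc m))
  w = axis s

  Qw≡P : B w w ≡ P
  Qw≡P = trans (B-axis s w) ss≡P

  c : Carrier
  c = B x w

  two≢0 : two ≢ 0#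
  two≢0 two≡0 = ξ-nonsquare (char2⇒square two≡0 ξ)

  module Swap (t : Carrier) (tt≡1 : t * t ≡ 1#) where
    u : Coords (suc (suc m))
    u i = x i + t * w i
    open Reflection u public

    B-x-u : B x u ≡ P + t * c
    B-x-u = begin
      B x u              ≡⟨ B-sym x u ⟩
      B u x              ≡⟨ B-addˡ x t w x ⟩
      P + t * B w x      ≡⟨ cong (λ a → P + t * a) (B-sym w x) ⟩
      P + t * c          ∎

    α-formula : α ≡ (P + t * c) + (P + t * c)
    α-formula = begin
      α                                   ≡⟨ Q-expand x t w ⟩
      P + (t + t) * c + (t * t) * B w w   ≡⟨ cong₂ (λ a b → P + (t + t) * c + a * b) tt≡1 Qw≡P ⟩
      P + (t + t) * c + 1# * P            ≡⟨ cong (P + (t + t) * c +_) (*-identityˡ P) ⟩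
      P + (t + t) * c + P                 ≡⟨ solve 3 (λ P t c → P :+ (t :+ t) :* c :+ P := (P :+ t :* c) :+ (P :+ t :* c))
                                               refl P t c ⟩
      (P + t * c) + (P + t * c)           ∎

    α≡2Bxu : α ≡ B x u + B x u
    α≡2Bxu = trans α-formula (sym (cong₂ _+_ B-x-u B-x-u))

    R-swaps : ∀ i → R x i ≡ (- (α * t)) * w i
    R-swaps i = begin
      α * x i + (- (b + b)) * u i
        ≡⟨ cong (λ a → a * x i + (- (b + b)) * u i) α≡2Bxu ⟩
      (b + b) * x i + (- (b + b)) * (x i + t * w i)
        ≡⟨ solve 4 (λ b xi t wi → (b :+ b) :* xi :+ (:- (b :+ b)) :* (xi :+ t :* wi) := (:- ((b :+ b) :* t)) :* wi)
             refl b (x i) t (w i) ⟩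
      (- ((b + b) * t)) * w i
        ≡⟨ cong (λ a → (- (a * t)) * w i) (sym α≡2Bxu) ⟩
      (- (α * t)) * w i ∎
      where
      b = B x u

    neighbourhood≅ : α ≢ 0# → Nbhd (Γ□ 𝔽 ξ (suc (suc m))) v ≅ Γ□ 𝔽 ξ (suc m)
    neighbourhood≅ α≢0 = ≅-trans
      -- the vertices are passed explicitly: ≈ only sees their coordinates
      (λ {a b c} → Nbhd-≈-trans (suc (suc m)) v {a} {b} {c}) (λ {a b c} → Γ□-≈-trans (suc m) {a} {b} {c})
      (reflect-Nbhd≅ α≢0 v (w , axis-vertex s≢0) (- (α * t))
        (-‿nonzero (*-nonzero α≢0 (unit-nonzero tt≡1))) R-swaps)
      (axis-Nbhd≅ s≢0)

  module Swap₊ = Swap 1# (*-identityˡ 1#)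
  module Swap₋ = Swap (- 1#) (trans (solve 1 (λ o → (:- o) :* (:- o) := o :* o) refl 1#) (*-identityˡ 1#))

  -- Q(x + w) + Q(x − w) = 4·Q(x) ≠ 0, so one of the two reflections is defined.
  Swap₊-defined : Swap₋.α ≡ 0# → Swap₊.α ≢ 0#
  Swap₊-defined α₋≡0 α₊≡0 = P≢0 (cancel-nonzero two≢0 (cancel-nonzero two≢0 (begin
    two * (two * P)   ≡⟨ cong (two *_) (sym (double P)) ⟩
    two * (P + P)     ≡⟨ sym (double (P + P)) ⟩
    (P + P) + (P + P)
      ≡⟨ solve 3 (λ P c o → (P :+ P) :+ (P :+ P) :=
           ((P :+ o :* c) :+ (P :+ o :* c)) :+ ((P :+ (:- o) :* c) :+ (P :+ (:- o) :* c))) refl P c 1# ⟩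
    ((P + 1# * c) + (P + 1# * c)) + ((P + (- 1#) * c) + (P + (- 1#) * c))
      ≡⟨ sym (cong₂ _+_ Swap₊.α-formula Swap₋.α-formula) ⟩
    Swap₊.α + Swap₋.α ≡⟨ cong₂ _+_ α₊≡0 α₋≡0 ⟩
    0# + 0#           ≡⟨ +-identityˡ 0# ⟩
    0#                ∎)))

  neighbourhood≅ : Nbhd (Γ□ 𝔽 ξ (suc (suc m))) v ≅ Γ□ 𝔽 ξ (suc m)
  neighbourhood≅ with Swap₋.α ≟ 0#
  ... | no  α₋≢0 = Swap₋.neighbourhood≅ α₋≢0
  ... | yes α₋≡0 = Swap₊.neighbourhood≅ (Swap₊-defined α₋≡0)

mainTheorem3 : (𝔽 : FiniteField) → OddPrimePowerOrder 𝔽 →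
    (ξ : FiniteField.Carrier 𝔽) → ¬ IsSquare 𝔽 ξ →
    (k : ℕ) → 3 ≤ k →
    (v : Graph.Vertex (Γ□ 𝔽 ξ k)) →
    Nbhd (Γ□ 𝔽 ξ k) v ≅ Γ□ 𝔽 ξ (k ∸ 1)
mainTheorem3 𝔽 _ ξ ξ-nonsquare (suc (suc (suc m))) _ v =
  Neighbourhood.neighbourhood≅ 𝔽 ξ ξ-nonsquare (suc m) v
mainTheorem3 𝔽 _ ξ _ (suc zero)       (s≤s ())       v
mainTheorem3 𝔽 _ ξ _ (suc (suc zero)) (s≤s (s≤s ())) v
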